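{- For every integer $n \geq 6$, $s(n)$ equals the number of partitions of $n$ with parts $p_1 \geq p_2 \geq \cdots \geq p_k$ such that: (a) $k \geq 3$; (b) the three largest parts are equal, $p_1 = p_2 = p_3$, and $p_3 \geq 3$; (c) the remaining parts $p_4, \dots, p_k$ (if any) are pairwise distinct; (d) if $k \geq 4$, then $p_4 \leq p_3 - 2$; (e) the smallest part is not $1$.
   Context: For $n \geq 0$ let $q(n)$ be the number of partitions of $n$ into distinct parts, with $q(0)=1$, and set $q(-1)=q(-2)=0$. Define $s(n) = q(n) - 2q(n-1) + q(n-2)$ for $n \geq 0$. -}

module Defs where

open import Data.Nat using (ℕ; _+_; _∸_; _≤_; _<_; _>_; _≥_)
open import Data.List using (List; []; _∷_)
open import Data.Nat.ListAction using (sum)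
open import Data.List.Relation.Unary.All using (All)
open import Data.List.Relation.Unary.Linked using (Linked)
open import Data.Product using (Σ; _×_)
open import Data.Fin using (Fin)
open import Function.Bundles using (_↔_)
open import Relation.Binary.PropositionalEquality using (_≡_)

record IsPartition (n : ℕ) (p : List ℕ) : Set where
  field
    nonincreasing : Linked _≥_ p
    positive      : All (λ x → 1 ≤ x) p
    sums          : sum p ≡ n

record IsDistinctPartition (n : ℕ) (p : List ℕ) : Set where
  field
    partition : IsPartition n p
    distinct  : Linked _>_ p

DistinctPartition : ℕ → Set
DistinctPartition n = Σ (List ℕ) (IsDistinctPartition n)

HasCard : ℕ → Set → Set
HasCard k A = Fin k ↔ A

data FourthCond (p₃ : ℕ) : List ℕ → Set where
  none : FourthCond p₃ []
  some : ∀ {p₄ rest} → p₄ ≤ p₃ ∸ 2 → FourthCond p₃ (p₄ ∷ rest)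

data SpecialShape : List ℕ → Set where
  shape : ∀ {p₁ p₂ p₃} (rest : List ℕ) →
    p₁ ≡ p₂ → p₂ ≡ p₃ → 3 ≤ p₃ →
    Linked _>_ rest →
    FourthCond p₃ rest →
    All (λ x → 2 ≤ x) (p₁ ∷ p₂ ∷ p₃ ∷ rest) →   -- (e) no part (so not the smallest) is 1
    SpecialShape (p₁ ∷ p₂ ∷ p₃ ∷ rest)

SpecialPartition : ℕ → Set
SpecialPartition n = Σ (List ℕ) (λ p → IsPartition n p × SpecialShape p)

{-# OPTIONS --safe #-}
-- Write d(n) for the number of partitions of n into distinct parts ≥ 2. Then
-- q(n) = d(n) + d(n - 1) (according to whether 1 is a part), so
-- s(n) = (d(n) - d(n - 1)) - (d(n - 2) - d(n - 3)). Raising the largest part by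
-- one shows that, for n ≥ 3, d(n) - d(n - 1) counts the partitions into distinct
-- parts ≥ 2 whose two largest parts are consecutive, c and c - 1. Lowering both of
-- these parts by one matches such partitions of n with those of n - 2, except
-- when the three largest parts are c, c - 1, c - 2; replacing those three parts
-- by c - 1, c - 1, c - 1 gives exactly the partitions counted by the theorem.
-- All counts are coefficients of truncated products ∏ (1 + xᵏ), so the
-- bijections above become identities between coefficient sequences.
module Submission where

open import Defs

module Counting where

  open import Data.Nat using (ℕ; zero; suc; _+_; _*_; _∸_; _≤_; _<_; _>_; z≤n; s≤s)
  open import Data.Nat.Properties
  open import Data.Nat.ListAction using (sum)
  open import Data.Nat.Tactic.RingSolver using (solve-∀)
  open import Data.List using (List; []; _∷_)
  open import Data.List.Relation.Unary.All as All using (All; []; _∷_)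
  open import Data.List.Relation.Unary.Linked as Linked using (Linked; []; [-]; _∷_)
  open import Data.Product using (Σ; _×_; _,_; proj₁; proj₂)
  open import Data.Product.Function.Dependent.Propositional using (Σ-↔)
  open import Data.Sum using (_⊎_; inj₁; inj₂)
  open import Data.Sum.Function.Propositional using (_⊎-↔_)
  open import Data.Empty using (⊥-elim)
  open import Data.Unit using (tt)
  open import Data.Fin.Properties using (+↔⊎; 0↔⊥; 1↔⊤)
  open import Data.Fin.Permutation using (↔⇒≡)
  open import Function.Bundles using (_↔_; mk↔ₛ′)
  open import Function.Properties.Inverse using (↔-sym; ↔-trans; ↔-refl)
  open import Relation.Binary.PropositionalEquality
  open import Relation.Nullary using (¬_; yes; no)
  open import Relation.Nullary.Irrelevant using (Irrelevant)

  δ : ℕ → ℕ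
  δ zero    = 1
  δ (suc _) = 0

  -- shift k f is the coefficient sequence of xᵏ · ∑ f(n) xⁿ.
  shift : ℕ → (ℕ → ℕ) → ℕ → ℕ
  shift zero    f n       = f n
  shift (suc k) f zero    = 0
  shift (suc k) f (suc n) = shift k f n

  shift-cong : ∀ k {f g} → (∀ m → f m ≡ g m) → ∀ n → shift k f n ≡ shift k g n
  shift-cong zero    f≡g n       = f≡g n
  shift-cong (suc k) f≡g zero    = refl
  shift-cong (suc k) f≡g (suc n) = shift-cong k f≡g n

  shift-+ : ∀ k f g n → shift k (λ m → f m + g m) n ≡ shift k f n + shift k g n
  shift-+ zero    f g n       = refl
  shift-+ (suc k) f g zero    = refl
  shift-+ (suc k) f g (suc n) = shift-+ k f g n

  shift-shift : ∀ a b f n → shift a (shift b f) n ≡ shift (a + b) f n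
  shift-shift zero    b f n       = refl
  shift-shift (suc a) b f zero    = refl
  shift-shift (suc a) b f (suc n) = shift-shift a b f n

  shift-below : ∀ k f {n} → n < k → shift k f n ≡ 0
  shift-below (suc k) f {zero}  _         = refl
  shift-below (suc k) f {suc n} (s≤s n<k) = shift-below k f n<k

  sumBelow : ℕ → (ℕ → ℕ) → ℕ
  sumBelow zero    f = 0
  sumBelow (suc N) f = f 0 + sumBelow N (λ i → f (suc i))

  sumBelow-cong : ∀ N {f g} → (∀ i → f i ≡ g i) → sumBelow N f ≡ sumBelow N g
  sumBelow-cong zero    f≡g = refl
  sumBelow-cong (suc N) f≡g = cong₂ _+_ (f≡g 0) (sumBelow-cong N (λ i → f≡g (suc i)))

  sumBelow-+ : ∀ N f g → sumBelow N (λ i → f i + g i) ≡ sumBelow N f + sumBelow N g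
  sumBelow-+ zero    f g = refl
  sumBelow-+ (suc N) f g =
    trans (cong (f 0 + g 0 +_) (sumBelow-+ N _ _)) (+-interchange (f 0) _ _ _)
    where
    +-interchange : ∀ a b c d → a + b + (c + d) ≡ a + c + (b + d)
    +-interchange = solve-∀

  sumBelow-suc : ∀ N f → sumBelow (suc N) f ≡ sumBelow N f + f N
  sumBelow-suc zero    f = +-comm (f 0) 0
  sumBelow-suc (suc N) f =
    trans (cong (f 0 +_) (sumBelow-suc N _)) (sym (+-assoc (f 0) _ _))

  shift-sumBelow : ∀ k N (F : ℕ → ℕ → ℕ) n →
    shift k (λ m → sumBelow N (λ i → F i m)) n ≡ sumBelow N (λ i → shift k (F i) n)
  shift-sumBelow zero    N       F n       = refl
  shift-sumBelow (suc k) zero    F zero    = refl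
  shift-sumBelow (suc k) (suc N) F zero    = sym (sumBelow-zero N)
    where
    sumBelow-zero : ∀ N → sumBelow N (λ _ → 0) ≡ 0
    sumBelow-zero zero    = refl
    sumBelow-zero (suc N) = sumBelow-zero N
  shift-sumBelow (suc k) N       F (suc n) = shift-sumBelow k N F n

  -- strictCount l j is the coefficient sequence of ∏_{l ≤ k < l + j} (1 + xᵏ).
  strictCount : ℕ → ℕ → ℕ → ℕ
  strictCount l zero    n = δ n
  strictCount l (suc j) n = strictCount l j n + shift (l + j) (strictCount l j) n

  shift-strictCount-suc : ∀ k l j n →
    shift k (strictCount l (suc j)) n ≡ shift k (strictCount l j) n + shift (k + (l + j)) (strictCount l j) n
  shift-strictCount-suc k l j n =
    trans (shift-+ k _ _ n) (cong (shift k (strictCount l j) n +_) (shift-shift k (l + j) _ n))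

  strictCount₁-split : ∀ j n → strictCount 1 (suc j) n ≡ strictCount 2 j n + shift 1 (strictCount 2 j) n
  strictCount₁-split zero    n = refl
  strictCount₁-split (suc j) n = begin
      strictCount 1 (suc j) n + shift (2 + j) (strictCount 1 (suc j)) n
    ≡⟨ cong₂ _+_ (strictCount₁-split j n) (shift-cong (2 + j) (strictCount₁-split j) n) ⟩
      (d n + shift 1 d n) + shift (2 + j) (λ m → d m + shift 1 d m) n
    ≡⟨ cong (d n + shift 1 d n +_) (trans (shift-+ (2 + j) d (shift 1 d) n)
                                         (cong (shift (2 + j) d n +_) (shift-shift (2 + j) 1 d n))) ⟩
      (d n + shift 1 d n) + (shift (2 + j) d n + shift (2 + j + 1) d n)
    ≡⟨ cong (λ k → (d n + shift 1 d n) + (shift (2 + j) d n + shift k d n)) (+-comm (2 + j) 1) ⟩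
      (d n + shift 1 d n) + (shift (2 + j) d n + shift (3 + j) d n)
    ≡⟨ +-interchange (d n) _ _ _ ⟩
      (d n + shift (2 + j) d n) + (shift 1 d n + shift (3 + j) d n)
    ≡⟨ cong (strictCount 2 (suc j) n +_) (sym (shift-strictCount-suc 1 2 j n)) ⟩
      strictCount 2 (suc j) n + shift 1 (strictCount 2 (suc j)) n
    ∎
    where
    open ≡-Reasoning
    d = strictCount 2 j
    +-interchange : ∀ a b c e → a + b + (c + e) ≡ a + c + (b + e)
    +-interchange = solve-∀

  -- topPair N n counts the partitions of n into distinct parts ≥ 2 whose two
  -- largest parts are 3 + i and 2 + i for some i < N.
  topPair : ℕ → ℕ → ℕ
  topPair N n = sumBelow N (λ i → shift ((3 + i) + (2 + i)) (strictCount 2 i) n)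

  topTriple : ℕ → ℕ → ℕ
  topTriple N n = sumBelow N (λ i → shift (3 * (3 + i)) (strictCount 2 i) n)

  -- (1 - x) ∏_{2 ≤ k < 3 + M} (1 + xᵏ) = 1 - x + x² + ∑ₙ topPair M n xⁿ - x³⁺ᴹ ∏_{2 ≤ k < 2 + M} (1 + xᵏ),
  -- with the negative terms moved to the other side.
  strictCount₂-firstDifference : ∀ M n →
    strictCount 2 (suc M) n + shift 1 δ n + shift (3 + M) (strictCount 2 M) n
      ≡ δ n + shift 2 δ n + shift 1 (strictCount 2 (suc M)) n + topPair M n
  strictCount₂-firstDifference zero n =
    trans (regroup (δ n) _ _ _)
          (cong (λ z → δ n + shift 2 δ n + z + 0) (sym (shift-strictCount-suc 1 2 0 n)))
    where
    regroup : ∀ a b c e → a + b + c + e ≡ a + b + (c + e) + 0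
    regroup = solve-∀
  strictCount₂-firstDifference (suc M) n = begin
      A + shift (3 + M) (d (suc M)) n + shift 1 δ n + X
    ≡⟨ cong (λ z → A + z + shift 1 δ n + X) (shift-strictCount-suc (3 + M) 2 M n) ⟩
      A + (B + C) + shift 1 δ n + X
    ≡⟨ regroupˡ A B C (shift 1 δ n) X ⟩
      (A + shift 1 δ n + B) + C + X
    ≡⟨ cong (λ z → z + C + X) (strictCount₂-firstDifference M n) ⟩
      (δ n + shift 2 δ n + Z + topPair M n) + C + X
    ≡⟨ regroupʳ (δ n + shift 2 δ n) Z (topPair M n) C X ⟩
      δ n + shift 2 δ n + (Z + X) + (topPair M n + C)
    ≡⟨ cong₂ (λ u v → δ n + shift 2 δ n + u + v)
             (sym (shift-strictCount-suc 1 2 (suc M) n)) (sym (sumBelow-suc M _)) ⟩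
      δ n + shift 2 δ n + shift 1 (d (suc (suc M))) n + topPair (suc M) n
    ∎
    where
    open ≡-Reasoning
    d = strictCount 2
    A = d (suc M) n
    B = shift (3 + M) (d M) n
    C = shift ((3 + M) + (2 + M)) (d M) n
    X = shift (4 + M) (d (suc M)) n
    Z = shift 1 (d (suc M)) n
    regroupˡ : ∀ a b c e x → a + (b + c) + e + x ≡ (a + e + b) + c + x
    regroupˡ = solve-∀
    regroupʳ : ∀ y z w c x → (y + z + w) + c + x ≡ y + (z + x) + (w + c)
    regroupʳ = solve-∀

  strictCount₂-step : ∀ M m → m < M →
    strictCount 2 (suc M) (3 + m) ≡ strictCount 2 (suc M) (2 + m) + topPair M (3 + m)
  strictCount₂-step M m m<M =
    trans (sym no-boundary) (strictCount₂-firstDifference M (3 + m))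
    where
    no-boundary :
      strictCount 2 (suc M) (3 + m) + 0 + shift M (strictCount 2 M) m ≡ strictCount 2 (suc M) (3 + m)
    no-boundary = trans (cong (strictCount 2 (suc M) (3 + m) + 0 +_) (shift-below M _ m<M))
                        (trans (+-identityʳ _) (+-identityʳ _))

  topPair-suc : ∀ N n → topPair (suc N) n ≡ shift 5 δ n + (shift 2 (topPair N) n + topTriple N n)
  topPair-suc N n = cong (shift 5 δ n +_) (begin
      sumBelow N (λ i → shift ((4 + i) + (3 + i)) (d (suc i)) n)
    ≡⟨ sumBelow-cong N split-term ⟩
      sumBelow N (λ i → shift 2 (shift ((3 + i) + (2 + i)) (d i)) n + shift (3 * (3 + i)) (d i) n)
    ≡⟨ sumBelow-+ N _ _ ⟩
      sumBelow N (λ i → shift 2 (shift ((3 + i) + (2 + i)) (d i)) n) + topTriple N n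
    ≡⟨ cong (_+ topTriple N n) (sym (shift-sumBelow 2 N _ n)) ⟩
      shift 2 (topPair N) n + topTriple N n
    ∎)
    where
    open ≡-Reasoning
    d = strictCount 2
    pair-exponent : ∀ i → (4 + i) + (3 + i) ≡ 2 + ((3 + i) + (2 + i))
    pair-exponent = solve-∀
    triple-exponent : ∀ i → (4 + i) + (3 + i) + (2 + i) ≡ 3 * (3 + i)
    triple-exponent = solve-∀
    split-term : ∀ i → shift ((4 + i) + (3 + i)) (d (suc i)) n
      ≡ shift 2 (shift ((3 + i) + (2 + i)) (d i)) n + shift (3 * (3 + i)) (d i) n
    split-term i = trans (shift-strictCount-suc ((4 + i) + (3 + i)) 2 i n) (cong₂ _+_
      (trans (cong (λ k → shift k (d i) n) (pair-exponent i)) (sym (shift-shift 2 _ (d i) n)))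
      (cong (λ k → shift k (d i) n) (triple-exponent i)))

  topPair-suc-below : ∀ N n → n < (3 + N) + (2 + N) → topPair (suc N) n ≡ topPair N n
  topPair-suc-below N n n<e =
    trans (sumBelow-suc N _) (trans (cong (topPair N n +_) (shift-below _ _ n<e)) (+-identityʳ _))

  topPair-step : ∀ N m → 4 + m < (3 + N) + (2 + N) →
    topPair (suc N) (6 + m) ≡ topPair (suc N) (4 + m) + topTriple N (6 + m)
  topPair-step N m 4+m<e = begin
      topPair (suc N) (6 + m)
    ≡⟨ topPair-suc N (6 + m) ⟩
      topPair N (4 + m) + topTriple N (6 + m)
    ≡⟨ cong (_+ topTriple N (6 + m)) (sym (topPair-suc-below N (4 + m) 4+m<e)) ⟩
      topPair (suc N) (4 + m) + topTriple N (6 + m)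
    ∎
    where open ≡-Reasoning

  hasCard-⊎ : ∀ {a b A B} → HasCard a A → HasCard b B → HasCard (a + b) (A ⊎ B)
  hasCard-⊎ a↔A b↔B = ↔-trans +↔⊎ (a↔A ⊎-↔ b↔B)

  hasCard-0 : ∀ {A} → ¬ A → HasCard 0 A
  hasCard-0 ¬A = ↔-trans 0↔⊥ (mk↔ₛ′ ⊥-elim ¬A (λ a → ⊥-elim (¬A a)) (λ ()))

  hasCard-unique : ∀ {a b A} → HasCard a A → HasCard b A → a ≡ b
  hasCard-unique a↔A b↔A = ↔⇒≡ (↔-trans a↔A (↔-sym b↔A))

  irrelevant-↔ : ∀ {A B : Set} → Irrelevant A → Irrelevant B → (A → B) → (B → A) → A ↔ B
  irrelevant-↔ irrA irrB f g = mk↔ₛ′ f g (λ _ → irrB _ _) (λ _ → irrA _ _)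

  ×-irrelevant : ∀ {A B : Set} → Irrelevant A → Irrelevant B → Irrelevant (A × B)
  ×-irrelevant irrA irrB (a , b) (a′ , b′) = cong₂ _,_ (irrA a a′) (irrB b b′)

  Shifted : ℕ → (ℕ → Set) → ℕ → Set
  Shifted k F n = Σ ℕ (λ m → k + m ≡ n × F m)

  shifted-card : ∀ {F f} → (∀ m → HasCard (f m) (F m)) → ∀ k n → HasCard (shift k f n) (Shifted k F n)
  shifted-card card zero    n       = ↔-trans (card n)
    (mk↔ₛ′ (λ x → n , refl , x) (λ { (_ , refl , x) → x }) (λ { (_ , refl , _) → refl }) (λ _ → refl))
  shifted-card card (suc k) zero    = hasCard-0 (λ { (_ , () , _) })
  shifted-card card (suc k) (suc n) = ↔-trans (shifted-card card k n)
    (mk↔ₛ′ (λ { (m , refl , x) → m , refl , x }) (λ { (m , refl , x) → m , refl , x })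
           (λ { (_ , refl , _) → refl }) (λ { (_ , refl , _) → refl }))

  Σℕ-uncons : ∀ {F : ℕ → Set} → (F 0 ⊎ Σ ℕ (λ i → F (suc i))) ↔ Σ ℕ F
  Σℕ-uncons = mk↔ₛ′
    (λ { (inj₁ x) → 0 , x ; (inj₂ (i , x)) → suc i , x })
    (λ { (zero , x) → inj₁ x ; (suc i , x) → inj₂ (i , x) })
    (λ { (zero , x) → refl ; (suc i , x) → refl })
    (λ { (inj₁ x) → refl ; (inj₂ (i , x)) → refl })

  Σℕ-card : ∀ N {F f} → (∀ i → HasCard (f i) (F i)) → (∀ i → N ≤ i → ¬ F i) →
            HasCard (sumBelow N f) (Σ ℕ F)
  Σℕ-card zero    card empty = hasCard-0 (λ { (i , x) → empty i z≤n x })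
  Σℕ-card (suc N) card empty = ↔-trans
    (hasCard-⊎ (card 0) (Σℕ-card N (λ i → card (suc i)) (λ i N≤i → empty (suc i) (s≤s N≤i))))
    Σℕ-uncons

  -- Partitions into distinct parts from [l, u)

  InRange : ℕ → ℕ → ℕ → Set
  InRange l u x = l ≤ x × x < u

  IsStrictIn : ℕ → ℕ → ℕ → List ℕ → Set
  IsStrictIn l u n xs = Linked _>_ xs × All (InRange l u) xs × sum xs ≡ n

  StrictIn : ℕ → ℕ → ℕ → Set
  StrictIn l u n = Σ (List ℕ) (IsStrictIn l u n)

  isStrictIn-irrelevant : ∀ {l u n xs} → Irrelevant (IsStrictIn l u n xs)
  isStrictIn-irrelevant = ×-irrelevant (Linked.irrelevant <-irrelevant)
    (×-irrelevant (All.irrelevant (×-irrelevant ≤-irrelevant <-irrelevant)) ≡-irrelevant)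

  strictIn-≡ : ∀ {l u n} {p q : StrictIn l u n} → proj₁ p ≡ proj₁ q → p ≡ q
  strictIn-≡ {p = xs , _} {q = .xs , _} refl = cong (xs ,_) (isStrictIn-irrelevant _ _)

  below-head : ∀ {x ys} → Linked _>_ (x ∷ ys) → All (_< x) ys
  below-head {ys = []}    _          = []
  below-head {ys = _ ∷ _} (y<x ∷ lk) = y<x ∷ All.map (λ z<y → <-trans z<y y<x) (below-head lk)

  cons-below : ∀ {x ys} → All (_< x) ys → Linked _>_ ys → Linked _>_ (x ∷ ys)
  cons-below []        _  = [-]
  cons-below (y<x ∷ _) lk = y<x ∷ lk

  tail-inRange : ∀ {l u x ys} → Linked _>_ (x ∷ ys) → All (InRange l u) ys → All (InRange l x) ys
  tail-inRange lk inRange = All.zipWith (λ ((l≤y , _) , y<x) → l≤y , y<x) (inRange , below-head lk)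

  inRange-suc : ∀ {l u xs} → All (InRange l u) xs → All (InRange l (suc u)) xs
  inRange-suc = All.map (λ (l≤x , x<u) → l≤x , m<n⇒m<1+n x<u)

  module _ {l u n : ℕ} (l≤u : l ≤ u) where

    without-largest : StrictIn l (suc u) n → StrictIn l u n ⊎ Shifted u (StrictIn l u) n
    without-largest ([] , [] , [] , s) = inj₁ ([] , [] , [] , s)
    without-largest (x ∷ ys , lk , (l≤x , x≤u) ∷ inRange , s) with x ≟ u
    ... | yes refl = inj₂ (sum ys , s , ys , Linked.tail lk , tail-inRange lk inRange , refl)
    ... | no x≢u   = inj₁ (x ∷ ys , lk , (l≤x , x<u) ∷ All.map below-u (tail-inRange lk inRange) , s)
      where
      x<u = ≤∧≢⇒< (≤-pred x≤u) x≢u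
      below-u : ∀ {y} → InRange l x y → InRange l u y
      below-u (l≤y , y<x) = l≤y , <-trans y<x x<u

    with-largest : StrictIn l u n ⊎ Shifted u (StrictIn l u) n → StrictIn l (suc u) n
    with-largest (inj₁ (xs , lk , inRange , s)) = xs , lk , inRange-suc inRange , s
    with-largest (inj₂ (_ , u+m≡n , ys , lk , inRange , sum≡m)) =
      u ∷ ys , cons-below (All.map proj₂ inRange) lk , (l≤u , ≤-refl) ∷ inRange-suc inRange ,
      trans (cong (u +_) sum≡m) u+m≡n

    without-with : ∀ p → without-largest (with-largest p) ≡ p
    without-with (inj₁ ([] , [] , [] , s)) = refl
    without-with (inj₁ (x ∷ ys , lk , (l≤x , x<u) ∷ inRange , s)) with x ≟ u
    ... | yes refl = ⊥-elim (<-irrefl refl x<u)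
    ... | no _     = cong inj₁ (strictIn-≡ refl)
    without-with (inj₂ (_ , u+m≡n , ys , lk , inRange , refl)) with u ≟ u
    ... | yes refl = cong (λ p → inj₂ (sum ys , u+m≡n , p)) (strictIn-≡ refl)
    ... | no u≢u   = ⊥-elim (u≢u refl)

    with-without : ∀ p → with-largest (without-largest p) ≡ p
    with-without ([] , [] , [] , s) = refl
    with-without (x ∷ ys , lk , (l≤x , x≤u) ∷ inRange , s) with x ≟ u
    ... | yes refl = strictIn-≡ refl
    ... | no _     = strictIn-≡ refl

    strictIn-split : (StrictIn l u n ⊎ Shifted u (StrictIn l u) n) ↔ StrictIn l (suc u) n
    strictIn-split = mk↔ₛ′ with-largest without-largest with-without without-with

  strictIn-empty : ∀ {l n} (p : StrictIn l l n) → proj₁ p ≡ []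
  strictIn-empty ([] , _)                             = refl
  strictIn-empty (_ ∷ _ , _ , (l≤x , x<l) ∷ _ , _) = ⊥-elim (<-irrefl refl (≤-<-trans l≤x x<l))

  strictIn-card : ∀ l j n → HasCard (strictCount l j n) (StrictIn l (l + j) n)
  strictIn-card l zero n rewrite +-identityʳ l = empty-range n
    where
    empty-range : ∀ n → HasCard (δ n) (StrictIn l l n)
    empty-range zero    = ↔-trans 1↔⊤ (mk↔ₛ′ (λ _ → [] , [] , [] , refl) (λ _ → tt)
                                              (λ p → strictIn-≡ (sym (strictIn-empty p))) (λ _ → refl))
    empty-range (suc n) = hasCard-0 λ p →
      0≢1+n (trans (cong sum (sym (strictIn-empty p))) (proj₂ (proj₂ (proj₂ p))))
  strictIn-card l (suc j) n rewrite +-suc l j = ↔-trans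
    (hasCard-⊎ (strictIn-card l j n) (shifted-card (strictIn-card l j) (l + j) n))
    (strictIn-split (m≤m+n l j))

  isPartition-irrelevant : ∀ {n p} → Irrelevant (IsPartition n p)
  isPartition-irrelevant record { nonincreasing = a ; positive = b ; sums = c }
                         record { nonincreasing = a′ ; positive = b′ ; sums = c′ }
    with Linked.irrelevant ≤-irrelevant a a′ | All.irrelevant ≤-irrelevant b b′ | ≡-irrelevant c c′
  ... | refl | refl | refl = refl

  isDistinctPartition-irrelevant : ∀ {n p} → Irrelevant (IsDistinctPartition n p)
  isDistinctPartition-irrelevant record { partition = a ; distinct = b }
                                 record { partition = a′ ; distinct = b′ }
    with isPartition-irrelevant a a′ | Linked.irrelevant <-irrelevant b b′
  ... | refl | refl = refl

  fourthCond-irrelevant : ∀ {c rest} → Irrelevant (FourthCond c rest)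
  fourthCond-irrelevant none     none     = refl
  fourthCond-irrelevant (some p) (some q) = cong some (≤-irrelevant p q)

  specialShape-irrelevant : ∀ {p} → Irrelevant (SpecialShape p)
  specialShape-irrelevant (shape rest refl refl a b c d) (shape .rest refl refl a′ b′ c′ d′)
    with ≤-irrelevant a a′ | Linked.irrelevant <-irrelevant b b′
       | fourthCond-irrelevant c c′ | All.irrelevant ≤-irrelevant d d′
  ... | refl | refl | refl | refl = refl

  parts≤sum : ∀ xs → All (_≤ sum xs) xs
  parts≤sum []       = []
  parts≤sum (x ∷ xs) =
    m≤m+n x (sum xs) ∷ All.map (λ y≤s → ≤-trans y≤s (m≤n+m (sum xs) x)) (parts≤sum xs)

  distinct↔strictIn : ∀ {n u} → n ≤ u → DistinctPartition n ↔ StrictIn 1 (suc u) n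
  distinct↔strictIn {n} {u} n≤u =
    Σ-↔ ↔-refl (irrelevant-↔ isDistinctPartition-irrelevant isStrictIn-irrelevant to from)
    where
    to : ∀ {xs} → IsDistinctPartition n xs → IsStrictIn 1 (suc u) n xs
    to {xs} record { partition = record { positive = pos ; sums = s } ; distinct = dist } =
      dist , All.zipWith (λ (1≤x , x≤s) → 1≤x , s≤s (≤-trans x≤s (subst (_≤ u) (sym s) n≤u)))
                         (pos , parts≤sum xs) , s
    from : ∀ {xs} → IsStrictIn 1 (suc u) n xs → IsDistinctPartition n xs
    from (dist , inRange , s) = record
      { partition = record
        { nonincreasing = Linked.map <⇒≤ dist ; positive = All.map proj₁ inRange ; sums = s }
      ; distinct  = dist }

  -- A special partition with p₃ = 3 + i is 3 + i, 3 + i, 3 + i followed by a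
  -- partition into distinct parts from [2, 2 + i).
  SpecialSplit : ℕ → Set
  SpecialSplit n = Σ ℕ (λ i → Shifted (3 * (3 + i)) (StrictIn 2 (2 + i)) n)

  three-copies : ∀ c r → c + (c + (c + r)) ≡ 3 * c + r
  three-copies = solve-∀

  fourthCond-all : ∀ {c rest} → FourthCond c rest → Linked _>_ rest → All (_≤ c ∸ 2) rest
  fourthCond-all none        _  = []
  fourthCond-all (some p₄≤c) lk =
    p₄≤c ∷ All.map (λ x<p₄ → ≤-trans (<⇒≤ x<p₄) p₄≤c) (below-head lk)

  module _ {n : ℕ} where

    special-split : SpecialPartition n → SpecialSplit n
    special-split (_ , isP , shape rest refl refl (s≤s (s≤s (s≤s (z≤n {i})))) lk fourth (_ ∷ _ ∷ _ ∷ rest≥2))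
      = i , sum rest , trans (sym (three-copies (3 + i) (sum rest))) (IsPartition.sums isP)
      , rest , lk
      , All.zipWith (λ (2≤x , x≤1+i) → 2≤x , s≤s x≤1+i) (rest≥2 , fourthCond-all fourth lk) , refl

    special-join : SpecialSplit n → SpecialPartition n
    special-join (i , _ , 3c+m≡n , rest , lk , inRange , sum≡m) =
      c ∷ c ∷ c ∷ rest ,
      record { nonincreasing = ≤-refl ∷ ≤-refl ∷ Linked.map <⇒≤ (cons-below rest<c lk)
             ; positive      = s≤s z≤n ∷ s≤s z≤n ∷ s≤s z≤n ∷ All.map (λ (2≤x , _) → <⇒≤ 2≤x) inRange
             ; sums          = trans (three-copies c (sum rest)) (trans (cong (3 * c +_) sum≡m) 3c+m≡n) } ,
      shape rest refl refl (s≤s (s≤s (s≤s z≤n))) lk (fourth inRange)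
            (s≤s (s≤s z≤n) ∷ s≤s (s≤s z≤n) ∷ s≤s (s≤s z≤n) ∷ All.map proj₁ inRange)
      where
      c = 3 + i
      rest<c : All (_< c) rest
      rest<c = All.map (λ (_ , x<2+i) → m<n⇒m<1+n x<2+i) inRange
      fourth : ∀ {rest} → All (InRange 2 (2 + i)) rest → FourthCond c rest
      fourth []                 = none
      fourth ((_ , x<2+i) ∷ _) = some (≤-pred x<2+i)

    split-join : ∀ p → special-split (special-join p) ≡ p
    split-join (i , _ , _ , rest , lk , inRange , refl) =
      cong (λ q → i , sum rest , q) (cong₂ _,_ (≡-irrelevant _ _) (strictIn-≡ refl))

    join-split : ∀ p → special-join (special-split p) ≡ p
    join-split (_ , isP , shape rest refl refl (s≤s (s≤s (s≤s z≤n))) lk fourth (_ ∷ _ ∷ _ ∷ _)) =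
      cong (_ ,_) (×-irrelevant isPartition-irrelevant specialShape-irrelevant _ _)

    special↔split : SpecialPartition n ↔ SpecialSplit n
    special↔split = mk↔ₛ′ special-split special-join split-join join-split

  special-card : ∀ N n → n < 3 * (3 + N) → HasCard (topTriple N n) (SpecialPartition n)
  special-card N n n<bound = ↔-trans
    (Σℕ-card N (λ i → shifted-card (strictIn-card 2 i) (3 * (3 + i)) n) too-large)
    (↔-sym special↔split)
    where
    too-large : ∀ i → N ≤ i → ¬ Shifted (3 * (3 + i)) (StrictIn 2 (2 + i)) n
    too-large i N≤i (m , e , _) = <-irrefl refl (begin-strict
      n                 <⟨ n<bound ⟩
      3 * (3 + N)       ≤⟨ *-monoʳ-≤ 3 (+-monoʳ-≤ 3 N≤i) ⟩
      3 * (3 + i)       ≤⟨ m≤m+n _ m ⟩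
      3 * (3 + i) + m   ≡⟨ e ⟩
      n                 ∎)
      where open ≤-Reasoning

  distinctCount : ∀ M {n q} → n ≤ 2 + M → HasCard q (DistinctPartition n) →
    q ≡ strictCount 2 (suc M) n + shift 1 (strictCount 2 (suc M)) n
  distinctCount M n≤2+M card = trans
    (hasCard-unique card (↔-trans (strictIn-card 1 (2 + M) _) (↔-sym (distinct↔strictIn n≤2+M))))
    (strictCount₁-split (suc M) _)

  second-difference-from : ∀ {q₀ q₁ q₂ d₀ d₁ d₂ d₃ e₀ e₂ c m} →
    q₀ ≡ d₀ + d₁ → q₁ ≡ d₁ + d₂ → q₂ ≡ d₂ + d₃ →
    d₀ ≡ d₁ + e₀ → d₂ ≡ d₃ + e₂ → e₀ ≡ e₂ + c → m ≡ c →
    q₀ + q₂ ≡ 2 * q₁ + m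
  second-difference-from {d₁ = d₁} {d₃ = d₃} {e₂ = e₂} {c = c} refl refl refl refl refl refl refl =
    identity d₁ d₃ e₂ c
    where
    identity : ∀ d₁ d₃ e₂ c → d₁ + (e₂ + c) + d₁ + (d₃ + e₂ + d₃) ≡ 2 * (d₁ + (d₃ + e₂)) + c
    identity = solve-∀

  distinct-second-difference : ∀ t {q₀ q₁ q₂ m} →
    HasCard q₀ (DistinctPartition (6 + t)) →
    HasCard q₁ (DistinctPartition (5 + t)) →
    HasCard q₂ (DistinctPartition (4 + t)) →
    HasCard m (SpecialPartition (6 + t)) →
    q₀ + q₂ ≡ 2 * q₁ + m
  distinct-second-difference t card₀ card₁ card₂ cardₘ = second-difference-from
    (distinctCount M (m≤n+m (6 + t) 3) card₀)
    (distinctCount M (m≤n+m (5 + t) 4) card₁)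
    (distinctCount M (m≤n+m (4 + t) 5) card₂)
    (strictCount₂-step M (3 + t) (m≤n+m (4 + t) 3))
    (strictCount₂-step M (1 + t) (m≤n+m (2 + t) 5))
    (topPair-step N t (≤-trans (m≤n+m (5 + t) 4) (m≤m+n (9 + t) (8 + t))))
    (hasCard-unique cardₘ (special-card N (6 + t) (≤-trans (m≤n+m (7 + t) 2) (m≤m+n (9 + t) _))))
    where
    -- any N ≥ 6 + t is a common bound for all the counts involved
    N = 6 + t
    M = suc N

open Counting using (distinct-second-difference)
open import Data.Nat as ℕ using (ℕ; _≤_; _∸_; _*_; z≤n; s≤s)
open import Data.Integer using (+_; _+_; _-_)
import Data.Integer.Properties as ℤ
open import Data.Integer.Tactic.RingSolver using (solve-∀)
open import Relation.Binary.PropositionalEquality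

+-≡⇒difference : ∀ {a b c d} → a ℕ.+ c ≡ b ℕ.+ d → (+ a - + b) + + c ≡ + d
+-≡⇒difference {a} {b} {c} {d} a+c≡b+d = begin
    (+ a - + b) + + c   ≡⟨ move-right (+ a) (+ b) (+ c) ⟩
    (+ a + + c) - + b   ≡⟨ cong (_- + b) a+c≡b+d-in-ℤ ⟩
    (+ b + + d) - + b   ≡⟨ cancel (+ b) (+ d) ⟩
    + d                 ∎
  where
  open ≡-Reasoning
  move-right : ∀ x y z → (x - y) + z ≡ (x + z) - y
  move-right = solve-∀
  cancel : ∀ y w → (y + w) - y ≡ w
  cancel = solve-∀
  a+c≡b+d-in-ℤ : + a + + c ≡ + b + + d
  a+c≡b+d-in-ℤ = trans (sym (ℤ.pos-+ a c)) (trans (cong +_ a+c≡b+d) (ℤ.pos-+ b d))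

corollary1p4 : ∀ (n : ℕ) → 6 ≤ n →
    ∀ {q₀ q₁ q₂ m : ℕ} →
    HasCard q₀ (DistinctPartition n) →
    HasCard q₁ (DistinctPartition (n ∸ 1)) →
    HasCard q₂ (DistinctPartition (n ∸ 2)) →
    HasCard m (SpecialPartition n) →
    (+ q₀ - + (2 * q₁)) + + q₂ ≡ + m
corollary1p4 _ (s≤s (s≤s (s≤s (s≤s (s≤s (s≤s (z≤n {t}))))))) card₀ card₁ card₂ cardₘ =
  +-≡⇒difference (distinct-second-difference t card₀ card₁ card₂ cardₘ)
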